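{- Let $t \ge 3$ be an integer and let $W_4 = C_4 + K_1$ be the wheel with four rim vertices. Then $M_t(W_4)$ is not a distance magic graph.
   Context: $C_4 + K_1$ denotes the join of the cycle $C_4$ with a single vertex. For a graph $G=(V,E)$ and an integer $t \ge 1$, the generalised Mycielskian $M_t(G)$ is the graph with vertex set $(V \times \{0,1,\dots,t-1\}) \cup \{u\}$ (where $u$ is a new vertex), whose edges are: $(x,0)(y,0)$ for every edge $xy \in E$; $(x,i)(y,i+1)$ for every $0 \le i \le t-2$ and every ordered pair $(x,y)$ with $xy \in E$; and $(x,t-1)u$ for every $x \in V$. A graph $H$ on $N$ vertices is distance magic if there is a bijection $f: V(H) \to \{1,2,\dots,N\}$ and a constant $k$ such that for every vertex $v$, $\sum_{w \in N(v)} f(w) = k$, where $N(v)$ is the open neighbourhood of $v$. -}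

module Defs where

open import Data.Nat using (ℕ; zero; suc; _+_; _*_)
open import Data.Fin using (Fin; zero; suc; toℕ; splitAt; remQuot)
open import Data.Nat.Properties using (_≟_)
open import Data.Bool using (Bool; true; false; _∧_; _∨_; not; if_then_else_)
open import Data.Sum using (_⊎_; inj₁; inj₂)
open import Data.Product using (_×_; _,_; Σ; ∃)
open import Data.Nat.ListAction using (sum)
open import Data.List using (List; map) renaming (allFin to allFinL)
open import Relation.Nullary.Decidable using (⌊_⌋)
open import Relation.Binary.PropositionalEquality using (_≡_)
open import Function.Bundles using (_⤖_; Bijection)

Adj : ℕ → Set
Adj n = Fin n → Fin n → Bool

neighSum : ∀ {n} → Adj n → (Fin n → ℕ) → Fin n → ℕ
neighSum {n} a f v = sum (map (λ w → if a v w then f w else 0) (allFinL n))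

-- Distance magic: a bijection f : V → {1,…,N} (encoded as a bijection
-- V ⤖ Fin N, with label toℕ (f v) + 1) and a constant k such that the
-- sum of labels over every open neighbourhood equals k.
IsDistanceMagic : ∀ {n} → Adj n → Set
IsDistanceMagic {n} a =
  Σ (Fin n ⤖ Fin n) λ f → Σ ℕ λ k →
    ∀ v → neighSum a (λ w → suc (toℕ (Bijection.to f w))) v ≡ k

w4adj : Adj 5
w4adj x y = edge (toℕ x) (toℕ y)
  where
  rim : ℕ → ℕ → Bool
  rim 0 1 = true
  rim 1 2 = true
  rim 2 3 = true
  rim 3 0 = true
  rim _ _ = false
  edge : ℕ → ℕ → Bool
  edge 4 4 = false
  edge 4 _ = true
  edge _ 4 = true
  edge i j = rim i j ∨ rim j i

-- Vertices of M_t(G): Fin (t * n + 1).  An index k < t*n corresponds to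
-- (x , i) ∈ V × {0..t-1} via remQuot n k = (i , x); the last index is u.
data MVert (t n : ℕ) : Set where
  layer : Fin t → Fin n → MVert t n
  apex  : MVert t n

decode : ∀ t n → Fin (t * n + 1) → MVert t n
decode t n k with splitAt (t * n) k
... | inj₁ j with remQuot {t} n j
...   | (i , x) = layer i x
decode t n k | inj₂ _ = apex

succLevel : ∀ {t} → Fin t → Fin t → Bool
succLevel i j = ⌊ suc (toℕ i) ≟ toℕ j ⌋

isLast : ∀ {t} → Fin t → Bool
isLast {t} i = ⌊ suc (toℕ i) ≟ t ⌋

mycAdj' : ∀ {t n} → Adj n → MVert t n → MVert t n → Bool
mycAdj' a (layer i x) (layer j y) =
  (⌊ toℕ i ≟ 0 ⌋ ∧ ⌊ toℕ j ≟ 0 ⌋ ∧ a x y)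
  ∨ ((succLevel i j ∨ succLevel j i) ∧ a x y)
mycAdj' a (layer i x) apex = isLast i
mycAdj' a apex (layer j y) = isLast j
mycAdj' a apex apex = false

mycielskian : ∀ t {n} → Adj n → Adj (t * n + 1)
mycielskian t {n} a k l = mycAdj' a (decode t n k) (decode t n l)

{-# OPTIONS --safe #-}
-- In M_t(W₄) with t ≥ 3, a vertex of level 0 sees levels 0 and 1, a vertex
-- of level 1 sees levels 0 and 2, and neither sees a level ≥ 3 or the apex.
-- Within such a level, the neighbourhood sums of two adjacent rim
-- vertices and of the hub are Y + X, Z + X and Z + Y, where X is the sum of
-- the two hub labels seen, and Y, Z the sums of the odd and even rim labels
-- seen. Equal sums force X = Y = Z, so X = k/2 for the magic constant k.
-- Levels 0 and 1 both see the hub of level 0, so the hubs of levels 1 and 2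
-- carry the same label, contradicting injectivity.
module Submission where

open import Defs
open import Data.Nat using (ℕ; zero; suc; _+_; _*_; _≥_; s≤s; ⌊_/2⌋)
open import Data.Nat.Properties using (+-cancelˡ-≡; +-identityʳ; n≡⌊n+n/2⌋; suc-injective)
open import Data.Nat.ListAction using (sum)
open import Data.Nat.ListAction.Properties using (sum-++)
open import Data.Nat.Tactic.RingSolver using (solve)
open import Data.Fin using (Fin; zero; suc; toℕ; splitAt; _↑ˡ_; _↑ʳ_; #_)
open import Data.Fin.Properties using (toℕ-injective)
open import Data.Bool using (Bool; false; if_then_else_)
open import Data.Sum using (inj₁; inj₂)
open import Data.List using (List; []; _∷_; map; tabulate; _++_)
open import Data.List.Properties using (map-++)
open import Data.Product using (_,_)
open import Relation.Nullary using (¬_)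
open import Relation.Binary.PropositionalEquality
open import Function using (_∘_)
open import Function.Bundles using (Bijection)

open ≡-Reasoning

pairwise-sums-equal : ∀ {X Y Z k} → Y + X ≡ k → Z + X ≡ k → Z + Y ≡ k → X ≡ ⌊ k /2⌋
pairwise-sums-equal {X} {Y} {Z} {k} yx zx zy = begin
  X              ≡⟨ n≡⌊n+n/2⌋ X ⟩
  ⌊ X + X /2⌋    ≡⟨ cong (λ w → ⌊ w + X /2⌋) X≡Y ⟩
  ⌊ Y + X /2⌋    ≡⟨ cong ⌊_/2⌋ yx ⟩
  ⌊ k /2⌋        ∎
  where
  X≡Y : X ≡ Y
  X≡Y = +-cancelˡ-≡ Z X Y (trans zx (sym zy))

-- The hypotheses are the neighbourhood sums, in normal form, of rim vertices
-- 0, 1 and of the hub 4 in a level whose neighbours carry the labels aᵢ and bᵢ.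
wheel-balance : ∀ a₀ a₁ a₂ a₃ a₄ b₀ b₁ b₂ b₃ b₄ {k} →
  a₁ + (a₃ + (a₄ + (b₁ + (b₃ + (b₄ + 0))))) ≡ k →
  a₀ + (a₂ + (a₄ + (b₀ + (b₂ + (b₄ + 0))))) ≡ k →
  a₀ + (a₁ + (a₂ + (a₃ + (b₀ + (b₁ + (b₂ + (b₃ + 0))))))) ≡ k →
  a₄ + b₄ ≡ ⌊ k /2⌋
wheel-balance a₀ a₁ a₂ a₃ a₄ b₀ b₁ b₂ b₃ b₄ {k} rim₀ rim₁ hub =
  pairwise-sums-equal {Y = a₁ + a₃ + b₁ + b₃} {Z = a₀ + a₂ + b₀ + b₂}
    (regroup rim₀ (solve vars)) (regroup rim₁ (solve vars)) (regroup hub (solve vars))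
  where
  vars : List ℕ
  vars = a₀ ∷ a₁ ∷ a₂ ∷ a₃ ∷ a₄ ∷ b₀ ∷ b₁ ∷ b₂ ∷ b₃ ∷ b₄ ∷ []
  regroup : ∀ {l r} → r ≡ k → l ≡ r → l ≡ k
  regroup r≡k l≡r = trans l≡r r≡k

data Near {m n} : MVert (3 + m) n → Set where
  level₀ : ∀ x → Near (layer zero x)
  level₁ : ∀ x → Near (layer (suc zero) x)

data Far {m n} : MVert (3 + m) n → Set where
  far-apex  : Far apex
  far-layer : ∀ j x → Far (layer (suc (suc (suc j))) x)

near-far-nonadjacent : ∀ {m n} (a : Adj n) {v w : MVert (3 + m) n} →
                       Near v → Far w → mycAdj' a v w ≡ false
near-far-nonadjacent a (level₀ x) far-apex          = refl
near-far-nonadjacent a (level₀ x) (far-layer j y)   = refl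
near-far-nonadjacent a (level₁ x) far-apex          = refl
near-far-nonadjacent a (level₁ x) (far-layer j y)   = refl

far-index : ∀ m (x : Fin (m * 5 + 1)) → Far (decode (3 + m) 5 (15 ↑ʳ x))
far-index m x with splitAt (m * 5) x
... | inj₁ j = far-layer _ _
... | inj₂ _ = far-apex

sum-map-if-false : ∀ {A : Set} {n} (c : A → Bool) (F : A → ℕ) (g : Fin n → A) →
                   (∀ j → c (g j) ≡ false) →
                   sum (map (λ w → if c w then F w else 0) (tabulate g)) ≡ 0
sum-map-if-false {n = zero}  c F g never = refl
sum-map-if-false {n = suc n} c F g never rewrite never zero =
  sum-map-if-false c F (g ∘ suc) (never ∘ suc)

levels≤2 : ∀ m → List (Fin ((3 + m) * 5 + 1))
levels≤2 m = tabulate {n = 15} (_↑ˡ (m * 5 + 1))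

module _ (m : ℕ) (a : Adj 5) (F : Fin ((3 + m) * 5 + 1) → ℕ) where

  neighSum-near : ∀ v → Near (decode (3 + m) 5 v) →
                  neighSum (mycielskian (3 + m) a) F v
                    ≡ sum (map (λ w → if mycielskian (3 + m) a v w then F w else 0) (levels≤2 m))
  -- allFin (15 + r) unfolds definitionally to levels≤2 m ++ deeper.
  neighSum-near v near = begin
    sum (map term (shallow ++ deeper))          ≡⟨ cong sum (map-++ term shallow deeper) ⟩
    sum (map term shallow ++ map term deeper)   ≡⟨ sum-++ (map term shallow) (map term deeper) ⟩
    sum (map term shallow) + sum (map term deeper)
      ≡⟨ cong (sum (map term shallow) +_) (sum-map-if-false (mycielskian (3 + m) a v) F (15 ↑ʳ_)
                                            (λ x → near-far-nonadjacent a near (far-index m x))) ⟩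
    sum (map term shallow) + 0                  ≡⟨ +-identityʳ _ ⟩
    sum (map term shallow)                      ∎
    where
    term : Fin ((3 + m) * 5 + 1) → ℕ
    term w = if mycielskian (3 + m) a v w then F w else 0
    shallow deeper : List (Fin ((3 + m) * 5 + 1))
    shallow = levels≤2 m
    deeper = tabulate (15 ↑ʳ_)

hub-labels-agree : ∀ m (F : Fin ((3 + m) * 5 + 1) → ℕ) {k} →
                   (∀ v → neighSum (mycielskian (3 + m) w4adj) F v ≡ k) →
                   F (# 9) ≡ F (# 14)
hub-labels-agree m F {k} magic =
  +-cancelˡ-≡ (F (# 4)) (F (# 9)) (F (# 14)) (trans balance₀ (sym balance₁))
  where
  -- Index 5 i + x is vertex x of level i; for these six vertices near-sum
  -- reduces to the normal forms that wheel-balance expects.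
  near-sum : ∀ v → Near (decode (3 + m) 5 v) →
             sum (map (λ w → if mycielskian (3 + m) w4adj v w then F w else 0) (levels≤2 m)) ≡ k
  near-sum v near = trans (sym (neighSum-near m w4adj F v near)) (magic v)

  balance₀ : F (# 4) + F (# 9) ≡ ⌊ k /2⌋
  balance₀ = wheel-balance (F (# 0)) (F (# 1)) (F (# 2)) (F (# 3)) (F (# 4))
                           (F (# 5)) (F (# 6)) (F (# 7)) (F (# 8)) (F (# 9))
               (near-sum (# 0) (level₀ _)) (near-sum (# 1) (level₀ _)) (near-sum (# 4) (level₀ _))

  balance₁ : F (# 4) + F (# 14) ≡ ⌊ k /2⌋
  balance₁ = wheel-balance (F (# 0)) (F (# 1)) (F (# 2)) (F (# 3)) (F (# 4))
                           (F (# 10)) (F (# 11)) (F (# 12)) (F (# 13)) (F (# 14))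
               (near-sum (# 5) (level₁ _)) (near-sum (# 6) (level₁ _)) (near-sum (# 9) (level₁ _))

lemma2p10 : (t : ℕ) → t ≥ 3 → ¬ IsDistanceMagic (mycielskian t w4adj)
lemma2p10 (suc (suc (suc m))) (s≤s (s≤s (s≤s _))) (f , k , magic) =
  hubs-distinct (Bijection.injective f same-image)
  where
  label : Fin ((3 + m) * 5 + 1) → ℕ
  label w = suc (toℕ (Bijection.to f w))
  same-image : Bijection.to f (# 9) ≡ Bijection.to f (# 14)
  same-image = toℕ-injective (suc-injective (hub-labels-agree m label magic))
  hubs-distinct : # 9 ≢ # 14
  hubs-distinct ()
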